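{- Let $X$ be the simplicial complex with vertex set $\mathbb N=\{1,2,\dots\}$ defined as follows, where $p_1=2,p_2=3,\dots$ is the sequence of primes in increasing order and the $m$-th binary digit of a positive integer $a$ means the coefficient of $2^m$ in its binary expansion: a pair $a_0<a_1$ is a 1-dimensional simplex of $X$ if and only if the $p_{a_0}$-th binary digit of $a_1$ equals $1$; and, inductively, an increasing sequence $0<a_0<a_1<\dots<a_k$ represents a simplex of $X$ if and only if all its proper (non-empty) subsequences represent simplexes of $X$ and the $(p_{a_0}p_{a_1}\cdots p_{a_{k-1}})$-th binary digit of $a_k$ equals $1$ (singletons are always simplexes). Then $X$ is a Rado complex.
   Context: A simplicial complex consists of a vertex set and a set of non-empty finite subsets (simplexes), closed under non-empty subsets and containing all singletons. For $U\subset V(X)$, $X_U$ is the induced subcomplex on $U$. A countable complex $X$ is a Rado complex if it is universal (every countable simplicial complex is isomorphic to an induced subcomplex of $X$) and homogeneous (every isomorphism between induced subcomplexes $X_U\to X_{U'}$ with $U,U'$ finite extends to an automorphism of $X$). -}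

module Defs where

open import Level using (0ℓ)
open import Data.Bool using (Bool; true; false; T; if_then_else_)
open import Data.Nat using (ℕ; zero; suc; _*_; _<_; _!)
open import Data.Nat.DivMod using (_/_; _%_)
open import Data.Nat.Primality using (prime?)
open import Data.List using (List; []; _∷_; [_]; map; length)
open import Data.List.Membership.Propositional using (_∈_)
open import Data.List.Relation.Binary.Sublist.Propositional using (_⊆_)
open import Data.List.Relation.Unary.Linked using (Linked)
open import Data.Product using (Σ; ∃; ∃-syntax; _×_; proj₁)
open import Data.Unit using (⊤)
open import Data.Empty using (⊥)
open import Function using (_⇔_; _↔_; Inverse)
open import Function.Definitions using (Injective)
open import Relation.Nullary using (¬_; does)
open import Relation.Binary.PropositionalEquality using (_≡_)

-- General simplicial complexes.
-- A (finite) simplex is represented by a list of vertices; the list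
-- stands for the finite set of its elements.

record Complex : Set₁ where
  field
    Vert : Set
    Simp : List Vert → Set
open Complex public

-- Axioms of a simplicial complex: simplexes are non-empty, closed under
-- non-empty subsets (this also makes Simp depend only on the underlying
-- set of the list), and every singleton is a simplex.
record IsComplex (K : Complex) : Set where
  field
    nonEmpty  : ∀ σ → Simp K σ → ¬ (σ ≡ [])
    downClosed : ∀ σ τ → Simp K σ → ¬ (τ ≡ []) →
                 (∀ v → v ∈ τ → v ∈ σ) → Simp K τ
    singleton : ∀ v → Simp K [ v ]

Countable : Complex → Set
Countable K = Σ (Vert K → ℕ) (λ f → Injective _≡_ _≡_ f)

Subset : Complex → Set
Subset K = Vert K → Bool

FiniteSubset : (K : Complex) → Subset K → Set
FiniteSubset K U = ∃[ xs ] (∀ v → T (U v) → v ∈ xs)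

Induced : (K : Complex) → Subset K → Complex
Induced K U = record
  { Vert = Σ (Vert K) (λ v → T (U v))
  ; Simp = λ σ → Simp K (map proj₁ σ)
  }

record Iso (K L : Complex) : Set where
  field
    bij      : Vert K ↔ Vert L
    preserve : ∀ σ → Simp K σ ⇔ Simp L (map (Inverse.to bij) σ)
open Iso public

isoMap : ∀ {K L} → Iso K L → Vert K → Vert L
isoMap φ = Inverse.to (bij φ)

Universal : Complex → Set₁
Universal K = (L : Complex) → IsComplex L → Countable L →
              Σ (Subset K) (λ U → Iso L (Induced K U))

Homogeneous : Complex → Set
Homogeneous K = (U U' : Subset K) → FiniteSubset K U → FiniteSubset K U' →
  (φ : Iso (Induced K U) (Induced K U')) →
  Σ (Iso K K) (λ ψ → ∀ v (u : T (U v)) →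
      proj₁ (isoMap φ (v Data.Product., u)) ≡ isoMap ψ v)

IsRado : Complex → Set₁
IsRado K = IsComplex K × Countable K × Universal K × Homogeneous K

binDigit : ℕ → ℕ → ℕ
binDigit a zero    = a % 2
binDigit a (suc m) = binDigit (a / 2) m

search : ℕ → ℕ → ℕ
search m zero    = m
search m (suc f) = if does (prime? m) then m else search (suc m) f

-- pr n = p_{n+1}, the (n+1)-th prime: pr 0 = 2, pr 1 = 3, ...
-- (Euclid: there is a prime in (q, q! + 1], so the search is exhaustive.)
pr : ℕ → ℕ
pr zero    = 2
pr (suc n) = search (suc (pr n)) (pr n !)

-- VERTEX CONVENTION: the vertex set ℕ = {1,2,...} of the paper is
-- represented by Agda's ℕ via v ↦ suc v; so Agda vertex v is the positive
-- integer a = suc v, and p_a = pr v.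

lastOf : ℕ → List ℕ → ℕ
lastOf a []      = a
lastOf a (b ∷ t) = lastOf b t

initProd : ℕ → List ℕ → ℕ
initProd a []      = 1
initProd a (b ∷ t) = pr a * initProd b t

-- Simplex condition on increasing sequences, by recursion on a length
-- bound n (proper subsequences are strictly shorter).
SimpSeq : ℕ → List ℕ → Set
SimpSeq zero    _               = ⊥
SimpSeq (suc n) []              = ⊥
SimpSeq (suc n) (a ∷ [])        = ⊤
SimpSeq (suc n) (a ∷ b ∷ rest)  =
  (∀ ys → ys ⊆ (a ∷ b ∷ rest) → ¬ (ys ≡ []) →
      length ys < length (a ∷ b ∷ rest) → SimpSeq n ys)
  × binDigit (suc (lastOf b rest)) (initProd a (b ∷ rest)) ≡ 1

XSimp : List ℕ → Set
XSimp σ = ∃[ xs ] (Linked _<_ xs × (∀ v → (v ∈ xs ⇔ v ∈ σ))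
                   × SimpSeq (length xs) xs)

X : Complex
X = record { Vert = ℕ ; Simp = XSimp }

module Submission where

-- X is a Rado complex: the classical back-and-forth argument.
--
-- A non-empty finite set σ
--    of vertices is a simplex of X iff it satisfies the digit condition: for
--    every m ∈ σ and every non-empty increasing R ⊆ σ below m, the digit of
--    m + 1 at position ∏_{r ∈ R} p_r is 1.  Hence X is a simplicial complex.
-- 2. Partial isomorphisms.  A finite partial isomorphism between complexes
--    K and L is a finite injective correspondence of vertices preserving and
--    reflecting simplexes; L has the extension property if every such
--    correspondence into L extends to every further vertex of K.
-- 3. Back and forth (with excluded middle, to decide membership questions
--    about arbitrary countable complexes): a countable complex with the
--    extension property is universal and homogeneous.
-- 4. X has the extension property: for a new vertex a choose b whose binary
--    digits at the codes ∏ p_r of faces R of the current image record which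
--    faces together with a span simplexes.  Distinct increasing R have
--    distinct codes (unique factorisation), and b exceeds the whole image.

open import Defs
open import Level using (0ℓ)
open import Axiom.ExcludedMiddle using (ExcludedMiddle)
open import Data.Bool using (Bool; true; false; T)
open import Data.Bool.Properties using (T-irrelevant)
open import Data.Empty using (⊥-elim)
open import Data.Unit using (⊤; tt)
open import Data.Nat
open import Data.Nat.Properties
open import Data.Nat.DivMod using ([m+kn]%n≡m%n; m*n%n≡0; m*n/n≡m; +-distrib-/)
open import Data.Nat.Divisibility using (_∣_; m∣m*n; ∣-trans; ∣m+n∣m⇒∣n; ∣1⇒≡1; ∣⇒≤; m≤n⇒m!∣n!)
open import Data.Nat.Primality using (Prime; prime?; prime[2]; euclidsLemma; prime⇒irreducible; prime⇒nonTrivial; prime⇒nonZero)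
open import Data.Nat.Primality.Factorisation using (factorise)
open import Data.Nat.ListAction using (product)
open import Data.List using (List; []; _∷_; [_]; _++_; map; length; deduplicate; initLast; _∷ʳ′_)
open import Data.List.Properties using (map-∘; map-id)
open import Data.List.Membership.Propositional using (_∈_)
open import Data.List.Membership.Propositional.Properties using (∈-map⁺; ∈-map⁻; ∈-deduplicate⁺; ∈-deduplicate⁻)
open import Data.List.Relation.Unary.Any as Any using (here; there)
open import Data.List.Relation.Unary.All as All using (All; []; _∷_)
open import Data.List.Relation.Unary.All.Properties using (∷ʳ⁺; ∷ʳ⁻)
open import Data.List.Relation.Unary.AllPairs using ([]; _∷_)
open import Data.List.Relation.Unary.Unique.Propositional using (Unique)
open import Data.List.Relation.Unary.Unique.DecPropositional.Properties _≟_ using (deduplicate-!)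
open import Data.List.Relation.Unary.Linked as Linked using (Linked; []; [-]; _∷_)
open import Data.List.Relation.Unary.Linked.Properties using (Linked⇒All)
open import Data.List.Relation.Binary.Pointwise using (Pointwise-≡⇒≡)
open import Data.List.Relation.Binary.Sublist.Propositional using (_⊆_; []; _∷_; _∷ʳ_; ⊆-refl; ⊆-trans; minimum; from∈)
open import Data.List.Relation.Binary.Sublist.Propositional.Properties using (Any-resp-⊆; length-mono-≤; to-≋)
open import Data.List.Relation.Binary.Subset.Propositional using () renaming (_⊆_ to _⊑_)
open import Data.List.Relation.Binary.Subset.Propositional.Properties using (∷⁺ʳ) renaming (map⁺ to ⊑-map⁺)
open import Data.List.Relation.Binary.Permutation.Propositional using (↭-sym; ↭⇒↭ₛ)
open import Data.List.Relation.Binary.Permutation.Propositional.Properties using (∈-resp-↭)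
open import Data.List.Relation.Binary.Permutation.Setoid.Properties using (Unique-resp-↭)
open import Data.List.Sort ≤-decTotalOrder using (sort; sort-↭; sort-↗)
open import Data.Product using (Σ; ∃; ∃-syntax; Σ-syntax; _×_; _,_; proj₁; proj₂; swap)
open import Data.Sum using (_⊎_; inj₁; inj₂) renaming ([_,_] to either; map₂ to ⊎-map₂)
open import Function using (id; _∘_; _⇔_; mk⇔; Equivalence; Injection; mk↔ₛ′)
open import Function.Properties.Inverse using (↔⇒↣)
open import Function.Properties.Equivalence using (⇔-setoid) renaming (sym to ⇔-sym)
open import Relation.Nullary using (¬_; Dec; yes; no; does; contradiction)
open import Relation.Nullary.Decidable using (T?; isYes; toWitness; fromWitness)
open import Relation.Binary using (tri<; tri≈; tri>)
open import Relation.Binary.PropositionalEquality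
  using (_≡_; _≢_; refl; sym; trans; cong; cong₂; subst; subst₂; setoid; module ≡-Reasoning)
import Relation.Binary.Reasoning.Setoid as SetoidReasoning

module ⇔-Reasoning = SetoidReasoning (⇔-setoid 0ℓ)

SameElements : {A : Set} → List A → List A → Set
SameElements xs ys = ∀ v → v ∈ xs ⇔ v ∈ ys

∈⇒≢[] : {A : Set} {x : A} {xs : List A} → x ∈ xs → xs ≢ []
∈⇒≢[] (here _)  ()
∈⇒≢[] (there _) ()

≢[]⇒∈ : {A : Set} {xs : List A} → xs ≢ [] → ∃[ x ] x ∈ xs
≢[]⇒∈ {xs = []}    xs≢[] = ⊥-elim (xs≢[] refl)
≢[]⇒∈ {xs = x ∷ _} _     = x , here refl

⊆-length-≡ : {A : Set} {ys xs : List A} → ys ⊆ xs → length ys ≡ length xs → ys ≡ xs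
⊆-length-≡ ys⊆xs same-length = Pointwise-≡⇒≡ (to-≋ same-length ys⊆xs)

lift-map : {A B : Set} (f : A → B) {xs : List A} (R : List B) →
           All (_∈ map f xs) R → ∃[ τ ] All (_∈ xs) τ × map f τ ≡ R
lift-map f []      []           = [] , [] , refl
lift-map f (r ∷ R) (r∈ ∷ R⊆) with ∈-map⁻ f r∈ | lift-map f R R⊆
... | p , p∈ , refl | τ , τ⊆ , refl = p ∷ τ , p∈ ∷ τ⊆ , refl

Increasing : List ℕ → Set
Increasing = Linked _<_

increasing-head : ∀ {x xs} → Increasing (x ∷ xs) → All (x <_) xs
increasing-head [-]        = []
increasing-head (x<y ∷ l) = Linked⇒All <-trans x<y l

increasing-cons : ∀ {x xs} → All (x <_) xs → Increasing xs → Increasing (x ∷ xs)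
increasing-cons []          _ = [-]
increasing-cons (x<y ∷ _) l = x<y ∷ l

increasing-⊆ : ∀ {ys xs} → ys ⊆ xs → Increasing xs → Increasing ys
increasing-⊆ []            _ = []
increasing-⊆ (_ ∷ʳ ys⊆xs) l = increasing-⊆ ys⊆xs (Linked.tail l)
increasing-⊆ (refl ∷ ys⊆xs) l =
  increasing-cons (All.tabulate (λ v∈ → All.lookup (increasing-head l) (Any-resp-⊆ ys⊆xs v∈)))
                  (increasing-⊆ ys⊆xs (Linked.tail l))

members⇒⊆ : ∀ {ys xs} → Increasing ys → Increasing xs → ys ⊑ xs → ys ⊆ xs
members⇒⊆ {[]}     {xs}     _  _  _ = minimum xs
members⇒⊆ {y ∷ ys} {[]}     _  _  h with h (here refl)
... | ()
members⇒⊆ {y ∷ ys} {x ∷ xs} ly lx h with y ≟ x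
... | yes refl = refl ∷ members⇒⊆ (Linked.tail ly) (Linked.tail lx)
                   (λ v∈ → Any.tail (>⇒≢ (All.lookup (increasing-head ly) v∈)) (h (there v∈)))
... | no y≢x = x ∷ʳ members⇒⊆ ly (Linked.tail lx) (λ v∈ → Any.tail (>⇒≢ (above v∈)) (h v∈))
  where
  x<y : x < y
  x<y = All.lookup (increasing-head lx) (Any.tail y≢x (h (here refl)))
  above : ∀ {v} → v ∈ y ∷ ys → x < v
  above (here refl) = x<y
  above (there v∈)  = <-trans x<y (All.lookup (increasing-head ly) v∈)

increasing-∷ʳ⁺ : ∀ {R m} → Increasing R → All (_< m) R → Increasing (R ++ [ m ])
increasing-∷ʳ⁺ {[]}    _ _               = [-]
increasing-∷ʳ⁺ {r ∷ R} l (r<m ∷ R<m) =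
  increasing-cons (∷ʳ⁺ (increasing-head l) r<m) (increasing-∷ʳ⁺ (Linked.tail l) R<m)

increasing-∷ʳ⁻ : ∀ R {m} → Increasing (R ++ [ m ]) → Increasing R × All (_< m) R
increasing-∷ʳ⁻ []      _ = [] , []
increasing-∷ʳ⁻ (r ∷ R) l with increasing-∷ʳ⁻ R (Linked.tail l) | ∷ʳ⁻ (increasing-head l)
... | R↑ , R<m | r<R , r<m = increasing-cons r<R R↑ , r<m ∷ R<m

enumerate : List ℕ → List ℕ
enumerate xs = sort (deduplicate _≟_ xs)

enumerate-increasing : ∀ xs → Increasing (enumerate xs)
enumerate-increasing xs = sorted∧unique⇒increasing (sort-↗ _) enumerate-unique
  where
  enumerate-unique : Unique (enumerate xs)
  enumerate-unique = Unique-resp-↭ (setoid ℕ) (↭⇒↭ₛ (↭-sym (sort-↭ _))) (deduplicate-! xs)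
  sorted∧unique⇒increasing : ∀ {ys} → Linked _≤_ ys → Unique ys → Increasing ys
  sorted∧unique⇒increasing []          _                   = []
  sorted∧unique⇒increasing [-]         _                   = [-]
  sorted∧unique⇒increasing (x≤y ∷ ys↑) ((x≢y ∷ _) ∷ ys!) = ≤∧≢⇒< x≤y x≢y ∷ sorted∧unique⇒increasing ys↑ ys!

enumerate-∈ : ∀ xs → SameElements (enumerate xs) xs
enumerate-∈ xs v = mk⇔ (λ v∈ → ∈-deduplicate⁻ _≟_ xs (∈-resp-↭ (sort-↭ _) v∈))
                       (λ v∈ → ∈-resp-↭ (↭-sym (sort-↭ _)) (∈-deduplicate⁺ _≟_ v∈))

search-≥ : ∀ m f → m ≤ search m f
search-≥ m zero    = ≤-refl
search-≥ m (suc f) with prime? m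
... | yes _ = ≤-refl
... | no  _ = ≤-trans (n≤1+n m) (search-≥ (suc m) f)

search-prime : ∀ m f {p} → Prime p → m ≤ p → p ≤ m + f → Prime (search m f)
search-prime m zero {p} p-prime m≤p p≤m+0 =
  subst Prime (≤-antisym (subst (p ≤_) (+-identityʳ m) p≤m+0) m≤p) p-prime
search-prime m (suc f) {p} p-prime m≤p p≤m+f with prime? m
... | yes m-prime = m-prime
... | no  m-composite with m≤n⇒m<n∨m≡n m≤p
...   | inj₁ m<p  = search-prime (suc m) f p-prime m<p (subst (p ≤_) (+-suc m f) p≤m+f)
...   | inj₂ refl = contradiction p-prime m-composite

∣factorial : ∀ {n m} → 1 ≤ n → n ≤ m → n ∣ m !
∣factorial {suc k} _ n≤m = ∣-trans (m∣m*n (k !)) (m≤n⇒m!∣n! n≤m)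

-- Euclid: q! + 1 has a prime factor, and each of its prime factors exceeds q.
prime-between : ∀ q → ∃[ p ] Prime p × q < p × p ≤ suc (q !)
prime-between q with factorise (suc (q !))
... | record { factors = [] ; isFactorisation = q!+1≡1 } = ⊥-elim (<⇒≢ (s≤s (1≤n! q)) (sym q!+1≡1))
... | record { factors = p ∷ ps ; isFactorisation = q!+1≡∏ ; factorsPrime = p-prime ∷ _ } =
  p , p-prime , q<p , ∣⇒≤ p∣q!+1
  where
  p∣q!+1 : p ∣ suc (q !)
  p∣q!+1 = subst (p ∣_) (sym q!+1≡∏) (m∣m*n (product ps))
  p>1 : 1 < p
  p>1 = nonTrivial⇒n>1 p {{prime⇒nonTrivial p-prime}}
  q<p : q < p
  q<p = ≰⇒> λ p≤q → >⇒≢ p>1 (∣1⇒≡1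
          (∣m+n∣m⇒∣n (subst (p ∣_) (+-comm 1 (q !)) p∣q!+1) (∣factorial (<⇒≤ p>1) p≤q)))

pr-prime : ∀ n → Prime (pr n)
pr-prime zero    = prime[2]
pr-prime (suc n) with prime-between (pr n)
... | p , p-prime , pr<p , p≤ = search-prime (suc (pr n)) (pr n !) p-prime pr<p
                                  (≤-trans p≤ (s≤s (m≤n+m (pr n !) (pr n))))

pr≥2 : ∀ n → 2 ≤ pr n
pr≥2 n = nonTrivial⇒n>1 (pr n) {{prime⇒nonTrivial (pr-prime n)}}

pr-mono : ∀ {m n} → m < n → pr m < pr n
pr-mono {m} {suc n} (s≤s m≤n) with m≤n⇒m<n∨m≡n m≤n
... | inj₁ m<n  = <-trans (pr-mono m<n) (search-≥ (suc (pr n)) (pr n !))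
... | inj₂ refl = search-≥ (suc (pr m)) (pr m !)

n<pr : ∀ n → n < pr n
n<pr zero    = s≤s z≤n
n<pr (suc n) = <-≤-trans (s≤s (n<pr n)) (pr-mono (n<1+n n))

primeProduct : List ℕ → ℕ
primeProduct []      = 1
primeProduct (r ∷ R) = pr r * primeProduct R

primeProduct≥1 : ∀ R → 1 ≤ primeProduct R
primeProduct≥1 []      = ≤-refl
primeProduct≥1 (r ∷ R) = *-mono-≤ (<⇒≤ (pr≥2 r)) (primeProduct≥1 R)

primeProduct>1 : ∀ r R → 1 < primeProduct (r ∷ R)
primeProduct>1 r R = *-mono-≤ (pr≥2 r) (primeProduct≥1 R)

primeProduct-⊆ : ∀ {R R'} → R ⊆ R' → primeProduct R ≤ primeProduct R'
primeProduct-⊆ []           = ≤-refl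
primeProduct-⊆ (r ∷ʳ R⊆R')  = ≤-trans (primeProduct-⊆ R⊆R') (m≤n*m _ (pr r) {{prime⇒nonZero (pr-prime r)}})
primeProduct-⊆ (_∷_ {x = r} refl R⊆R') = *-monoʳ-≤ (pr r) (primeProduct-⊆ R⊆R')

pr∤primeProduct : ∀ {x ys} → All (x <_) ys → ¬ (pr x ∣ primeProduct ys)
pr∤primeProduct {x} {[]}     []            p∣1 = <⇒≢ (pr≥2 x) (sym (∣1⇒≡1 p∣1))
pr∤primeProduct {x} {y ∷ ys} (x<y ∷ x<ys) p∣  with euclidsLemma (pr y) (primeProduct ys) (pr-prime x) p∣
... | inj₂ p∣rest = pr∤primeProduct x<ys p∣rest
... | inj₁ p∣py with prime⇒irreducible (pr-prime y) p∣py
...   | inj₁ px≡1  = <⇒≢ (pr≥2 x) (sym px≡1)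
...   | inj₂ px≡py = <⇒≢ (pr-mono x<y) px≡py

primeProduct-injective : ∀ {R R'} → Increasing R → Increasing R' → primeProduct R ≡ primeProduct R' → R ≡ R'
primeProduct-injective {[]}     {[]}     _ _  _ = refl
primeProduct-injective {[]}     {y ∷ ys} _ _  e = ⊥-elim (<⇒≢ (primeProduct>1 y ys) e)
primeProduct-injective {x ∷ xs} {[]}     _ _  e = ⊥-elim (<⇒≢ (primeProduct>1 x xs) (sym e))
primeProduct-injective {x ∷ xs} {y ∷ ys} l l' e with <-cmp x y
... | tri< x<y _ _ = ⊥-elim (pr∤primeProduct (Linked⇒All <-trans x<y l') (subst (pr x ∣_) e (m∣m*n _)))
... | tri> _ _ y<x = ⊥-elim (pr∤primeProduct (Linked⇒All <-trans y<x l) (subst (pr y ∣_) (sym e) (m∣m*n _)))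
... | tri≈ _ refl _ = cong (x ∷_) (primeProduct-injective (Linked.tail l) (Linked.tail l')
                        (*-cancelˡ-≡ (primeProduct xs) (primeProduct ys) (pr x) {{prime⇒nonZero (pr-prime x)}} e))

digitValue : Bool → ℕ
digitValue true  = 1
digitValue false = 0

digitValue-does : ∀ {A : Set} (d : Dec A) → digitValue (does d) ≡ 1 ⇔ A
digitValue-does (yes a) = mk⇔ (λ _ → a) (λ _ → refl)
digitValue-does (no ¬a) = mk⇔ (λ ()) (λ a → contradiction a ¬a)

withDigits : ℕ → (ℕ → Bool) → ℕ
withDigits zero    g = 1
withDigits (suc n) g = digitValue (g 0) + withDigits n (g ∘ suc) * 2

withDigits>n : ∀ n g → n < withDigits n g
withDigits>n zero    g = s≤s z≤n
withDigits>n (suc n) g =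
  ≤-trans (s≤s (s≤s (m≤m*n n 2))) (≤-trans (*-monoˡ-≤ 2 (withDigits>n n (g ∘ suc))) (m≤n+m _ _))

lowest-digit : ∀ d k → (digitValue d + k * 2) % 2 ≡ digitValue d
lowest-digit true  k = [m+kn]%n≡m%n 1 k 2
lowest-digit false k = m*n%n≡0 k 2

halve : ∀ d k → (digitValue d + k * 2) / 2 ≡ k
halve false k = m*n/n≡m k 2
halve true  k = trans (+-distrib-/ 1 (k * 2) (subst (λ z → 1 + z < 2) (sym (m*n%n≡0 k 2)) ≤-refl)) (m*n/n≡m k 2)

withDigits-digit : ∀ n g {j} → j < n → binDigit (withDigits n g) j ≡ digitValue (g j)
withDigits-digit (suc n) g {zero}  _ = lowest-digit (g 0) (withDigits n (g ∘ suc))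
withDigits-digit (suc n) g {suc j} (s≤s j<n) = begin
  binDigit (withDigits (suc n) g / 2) j    ≡⟨ cong (λ w → binDigit w j) (halve (g 0) _) ⟩
  binDigit (withDigits n (g ∘ suc)) j      ≡⟨ withDigits-digit n (g ∘ suc) j<n ⟩
  digitValue (g (suc j))                   ∎
  where open ≡-Reasoning

-- The digit of vertex m selected by the face R (recall that Agda's vertex m is the integer m + 1).
faceDigit : ℕ → List ℕ → ℕ
faceDigit m R = binDigit (suc m) (primeProduct R)

DigitCondition : List ℕ → Set
DigitCondition σ = ∀ m R → m ∈ σ → R ≢ [] → Increasing R → All (_< m) R → All (_∈ σ) R → faceDigit m R ≡ 1

TopDigit : List ℕ → Set
TopDigit []             = ⊤
TopDigit (a ∷ [])       = ⊤
TopDigit (a ∷ b ∷ rest) = binDigit (suc (lastOf b rest)) (initProd a (b ∷ rest)) ≡ 1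

AllTopDigits : List ℕ → Set
AllTopDigits xs = ∀ {ys} → ys ⊆ xs → TopDigit ys

SimpSeq⇒allTopDigits : ∀ n xs → SimpSeq n xs → AllTopDigits xs
SimpSeq⇒allTopDigits _       _           _ {[]}    _ = tt
SimpSeq⇒allTopDigits _       _           _ {_ ∷ []} _ = tt
SimpSeq⇒allTopDigits zero    _           () {_ ∷ _ ∷ _}
SimpSeq⇒allTopDigits (suc n) []          () {_ ∷ _ ∷ _}
SimpSeq⇒allTopDigits (suc n) (x ∷ [])    _  {_ ∷ _ ∷ _} ys⊆ with length-mono-≤ ys⊆
... | s≤s ()
SimpSeq⇒allTopDigits (suc n) (x ∷ y ∷ r) (faces , top) {ys@(_ ∷ _ ∷ _)} ys⊆
  with length ys ≟ length (x ∷ y ∷ r)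
... | yes same-length with ⊆-length-≡ ys⊆ same-length
...   | refl = top
SimpSeq⇒allTopDigits (suc n) (x ∷ y ∷ r) (faces , top) {ys@(_ ∷ _ ∷ _)} ys⊆ | no different-length =
  SimpSeq⇒allTopDigits n ys (faces ys ys⊆ (λ ()) (≤∧≢⇒< (length-mono-≤ ys⊆) different-length)) ⊆-refl

allTopDigits⇒SimpSeq : ∀ n xs → xs ≢ [] → length xs ≤ n → AllTopDigits xs → SimpSeq n xs
allTopDigits⇒SimpSeq _       []          xs≢[] _       _    = ⊥-elim (xs≢[] refl)
allTopDigits⇒SimpSeq zero    (x ∷ xs)    _     ()      _
allTopDigits⇒SimpSeq (suc n) (x ∷ [])    _     _       _    = tt
allTopDigits⇒SimpSeq (suc n) (x ∷ y ∷ r) _     (s≤s ≤n) tops =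
  (λ ys ys⊆ ys≢[] shorter → allTopDigits⇒SimpSeq n ys ys≢[] (≤-trans (≤-pred shorter) ≤n)
                              (λ zs⊆ → tops (⊆-trans zs⊆ ys⊆)))
  , tops ⊆-refl

lastOf-++ : ∀ a t m → lastOf a (t ++ [ m ]) ≡ m
lastOf-++ a []      m = refl
lastOf-++ a (b ∷ t) m = lastOf-++ b t m

initProd-++ : ∀ a t m → initProd a (t ++ [ m ]) ≡ primeProduct (a ∷ t)
initProd-++ a []      m = refl
initProd-++ a (b ∷ t) m = cong (pr a *_) (initProd-++ b t m)

topDigit-++ : ∀ r R m → TopDigit ((r ∷ R) ++ [ m ]) ≡ (faceDigit m (r ∷ R) ≡ 1)
topDigit-++ r []      m = refl
topDigit-++ r (s ∷ R) m =
  cong₂ (λ top code → binDigit (suc top) code ≡ 1) (lastOf-++ s R m) (initProd-++ r (s ∷ R) m)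

module _ {xs σ} (xs↑ : Increasing xs) (same : SameElements xs σ) where

  allTopDigits⇒digitCondition : AllTopDigits xs → DigitCondition σ
  allTopDigits⇒digitCondition tops m []      _   R≢[] = contradiction refl R≢[]
  allTopDigits⇒digitCondition tops m (r ∷ R) m∈σ _ R↑ R<m R⊆σ =
    subst id (topDigit-++ r R m) (tops (members⇒⊆ (increasing-∷ʳ⁺ R↑ R<m) xs↑ in-xs))
    where
    in-xs : ∀ {v} → v ∈ (r ∷ R) ++ [ m ] → v ∈ xs
    in-xs v∈ = Equivalence.from (same _) (All.lookup (∷ʳ⁺ R⊆σ m∈σ) v∈)

  digitCondition⇒allTopDigits : DigitCondition σ → AllTopDigits xs
  digitCondition⇒allTopDigits dc {ys} ys⊆ with initLast ys
  ... | []             = tt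
  ... | [] ∷ʳ′ m       = tt
  ... | (r ∷ R) ∷ʳ′ m  with increasing-∷ʳ⁻ (r ∷ R) (increasing-⊆ ys⊆ xs↑)
                          | ∷ʳ⁻ (All.tabulate (λ v∈ → Equivalence.to (same _) (Any-resp-⊆ ys⊆ v∈)))
  ...   | R↑ , R<m | R⊆σ , m∈σ =
    subst id (sym (topDigit-++ r R m)) (dc m (r ∷ R) m∈σ (λ ()) R↑ R<m R⊆σ)

XSimp⇒digitCondition : ∀ {σ} → XSimp σ → DigitCondition σ
XSimp⇒digitCondition (xs , xs↑ , same , seq) =
  allTopDigits⇒digitCondition xs↑ same (SimpSeq⇒allTopDigits _ xs seq)

digitCondition⇒XSimp : ∀ {σ} → σ ≢ [] → DigitCondition σ → XSimp σ
digitCondition⇒XSimp {σ} σ≢[] dc =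
  enumerate σ , enumerate-increasing σ , enumerate-∈ σ ,
  allTopDigits⇒SimpSeq _ (enumerate σ) enumeration≢[] ≤-refl
    (digitCondition⇒allTopDigits (enumerate-increasing σ) (enumerate-∈ σ) dc)
  where
  enumeration≢[] : enumerate σ ≢ []
  enumeration≢[] = ∈⇒≢[] (Equivalence.from (enumerate-∈ σ _) (proj₂ (≢[]⇒∈ σ≢[])))

XSimp-nonEmpty : ∀ {σ} → XSimp σ → σ ≢ []
XSimp-nonEmpty ([]     , _ , _    , ())
XSimp-nonEmpty (x ∷ xs , _ , same , _) = ∈⇒≢[] (Equivalence.to (same x) (here refl))

digitCondition-⊆ : ∀ {σ τ} → (∀ v → v ∈ τ → v ∈ σ) → DigitCondition σ → DigitCondition τ
digitCondition-⊆ τ⊆σ dc m R m∈τ R≢[] R↑ R<m R⊆τ = dc m R (τ⊆σ m m∈τ) R≢[] R↑ R<m (All.map (τ⊆σ _) R⊆τ)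

X-isComplex : IsComplex X
X-isComplex = record
  { nonEmpty   = λ _ → XSimp-nonEmpty
  ; downClosed = λ σ τ σ-simp τ≢[] τ⊆σ →
      digitCondition⇒XSimp τ≢[] (digitCondition-⊆ τ⊆σ (XSimp⇒digitCondition σ-simp))
  ; singleton  = λ v → [ v ] , [-] , (λ _ → mk⇔ (λ v∈ → v∈) (λ v∈ → v∈)) , tt
  }

simplex-⇔ : ∀ {K} → IsComplex K → ∀ {σ τ} → SameElements σ τ → Simp K σ ⇔ Simp K τ
simplex-⇔ {K} isK same = mk⇔ (resp same) (resp (λ v → ⇔-sym (same v)))
  where
  resp : ∀ {σ τ} → SameElements σ τ → Simp K σ → Simp K τ
  resp {σ} {τ} same σ-simp = IsComplex.downClosed isK σ τ σ-simp τ≢[] (λ v → Equivalence.from (same v))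
    where
    τ≢[] : τ ≢ []
    τ≢[] = ∈⇒≢[] (Equivalence.to (same _) (proj₂ (≢[]⇒∈ (IsComplex.nonEmpty isK σ σ-simp))))

map-SameElements : {A B : Set} (f : A → B) {xs ys : List A} → SameElements xs ys → SameElements (map f xs) (map f ys)
map-SameElements f same v =
  mk⇔ (⊑-map⁺ f (λ {x} → Equivalence.to (same x))) (⊑-map⁺ f (λ {x} → Equivalence.from (same x)))

Pairs : Complex → Complex → Set
Pairs K L = List (Vert K × Vert L)

record PartialIso (K L : Complex) (P : Pairs K L) : Set where
  field
    sameVertex : ∀ {p q} → p ∈ P → q ∈ P → (proj₁ p ≡ proj₁ q ⇔ proj₂ p ≡ proj₂ q)
    sameSimp   : ∀ σ → All (_∈ P) σ → Simp K (map proj₁ σ) ⇔ Simp L (map proj₂ σ)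
open PartialIso

-- The empty partial isomorphism (vacuous, as no simplex is empty).
emptyPartialIso : ∀ {K L} → IsComplex K → IsComplex L → PartialIso K L []
emptyPartialIso isK isL = record
  { sameVertex = λ ()
  ; sameSimp   = λ { [] [] → mk⇔ (λ s → ⊥-elim (IsComplex.nonEmpty isK [] s refl))
                                 (λ s → ⊥-elim (IsComplex.nonEmpty isL [] s refl)) }
  }

swapPartialIso : ∀ {K L P} → PartialIso K L P → PartialIso L K (map swap P)
swapPartialIso {K} {L} {P} iso = record
  { sameVertex = λ p∈ q∈ → ⇔-sym (sameVertex iso (unswap p∈) (unswap q∈))
  ; sameSimp   = λ σ σ⊆ → ⇔-sym (subst₂ _⇔_ (cong (Simp K) (sym (map-∘ σ))) (cong (Simp L) (sym (map-∘ σ)))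
                                   (sameSimp iso (map swap σ) (All.tabulate (unswapped σ⊆))))
  }
  where
  unswap : ∀ {p} → p ∈ map swap P → swap p ∈ P
  unswap p∈ with ∈-map⁻ swap p∈
  ... | q , q∈ , refl = q∈
  unswapped : ∀ {σ p} → All (_∈ map swap P) σ → p ∈ map swap σ → p ∈ P
  unswapped σ⊆ p∈ with ∈-map⁻ swap p∈
  ... | q , q∈ , refl = unswap (All.lookup σ⊆ q∈)

sameDomain : ∀ {K L P} → PartialIso K L P → ∀ {σ τ} → All (_∈ P) σ → All (_∈ P) τ →
             map proj₂ σ ⊑ map proj₂ τ → map proj₁ σ ⊑ map proj₁ τ
sameDomain iso {τ = τ} σ⊆ τ⊆ images x∈ with ∈-map⁻ proj₁ x∈
... | p , p∈σ , refl with ∈-map⁻ proj₂ (images (∈-map⁺ proj₂ p∈σ))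
...   | q , q∈τ , p₂≡q₂ =
  subst (_∈ map proj₁ τ) (sym (Equivalence.from (sameVertex iso (All.lookup σ⊆ p∈σ) (All.lookup τ⊆ q∈τ)) p₂≡q₂))
        (∈-map⁺ proj₁ q∈τ)

module _ {K L} (isK : IsComplex K) (isL : IsComplex L) {P : Pairs K L} (iso : PartialIso K L P)
         {a : Vert K} {b : Vert L}
         (new : ∀ {q} → q ∈ P → a ≢ proj₁ q × b ≢ proj₂ q)
         (cone : ∀ σ₀ → All (_∈ P) σ₀ → Simp K (a ∷ map proj₁ σ₀) ⇔ Simp L (b ∷ map proj₂ σ₀)) where

  newOrOld : ∀ σ → All (_∈ (a , b) ∷ P) σ → (a , b) ∈ σ ⊎ All (_∈ P) σ
  newOrOld []      []              = inj₂ []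
  newOrOld (p ∷ σ) (here p≡ab ∷ _) = inj₁ (here (sym p≡ab))
  newOrOld (p ∷ σ) (there p∈ ∷ σ⊆) = either (λ ab∈ → inj₁ (there ab∈)) (λ σ⊆P → inj₂ (p∈ ∷ σ⊆P)) (newOrOld σ σ⊆)

  oldPairs : ∀ σ → All (_∈ (a , b) ∷ P) σ → Pairs K L
  oldPairs []      []              = []
  oldPairs (p ∷ σ) (here _ ∷ σ⊆)  = oldPairs σ σ⊆
  oldPairs (p ∷ σ) (there _ ∷ σ⊆) = p ∷ oldPairs σ σ⊆

  oldPairs⊆P : ∀ σ σ⊆ → All (_∈ P) (oldPairs σ σ⊆)
  oldPairs⊆P []      []              = []
  oldPairs⊆P (p ∷ σ) (here _ ∷ σ⊆)   = oldPairs⊆P σ σ⊆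
  oldPairs⊆P (p ∷ σ) (there p∈ ∷ σ⊆) = p∈ ∷ oldPairs⊆P σ σ⊆

  oldPairs⊆σ : ∀ σ σ⊆ {p} → p ∈ oldPairs σ σ⊆ → p ∈ σ
  oldPairs⊆σ (p ∷ σ) (here _ ∷ σ⊆)  q∈          = there (oldPairs⊆σ σ σ⊆ q∈)
  oldPairs⊆σ (p ∷ σ) (there _ ∷ σ⊆) (here refl) = here refl
  oldPairs⊆σ (p ∷ σ) (there _ ∷ σ⊆) (there q∈)  = there (oldPairs⊆σ σ σ⊆ q∈)

  σ⊆oldPairs : ∀ σ σ⊆ {p} → p ∈ σ → p ≡ (a , b) ⊎ p ∈ oldPairs σ σ⊆
  σ⊆oldPairs (p ∷ σ) (here p≡ab ∷ _) (here refl) = inj₁ p≡ab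
  σ⊆oldPairs (p ∷ σ) (there _ ∷ _)   (here refl) = inj₂ (here refl)
  σ⊆oldPairs (p ∷ σ) (here _ ∷ σ⊆)   (there q∈)  = σ⊆oldPairs σ σ⊆ q∈
  σ⊆oldPairs (p ∷ σ) (there _ ∷ σ⊆)  (there q∈)  = ⊎-map₂ there (σ⊆oldPairs σ σ⊆ q∈)

  oldPairs-same : ∀ σ σ⊆ → (a , b) ∈ σ → SameElements σ ((a , b) ∷ oldPairs σ σ⊆)
  oldPairs-same σ σ⊆ ab∈σ p = mk⇔
    (λ p∈ → either (λ { refl → here refl }) there (σ⊆oldPairs σ σ⊆ p∈))
    (λ { (here refl) → ab∈σ ; (there p∈) → oldPairs⊆σ σ σ⊆ p∈ })

  -- Pairs involving (a , b) are compatible since a and b are new; a list of pairs containing (a , b)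
  -- spans the same simplexes as (a , b) together with its old pairs, to which  cone  applies.
  extendPartialIso : PartialIso K L ((a , b) ∷ P)
  sameVertex extendPartialIso (here refl) (here refl) = mk⇔ (λ _ → refl) (λ _ → refl)
  sameVertex extendPartialIso (here refl) (there q∈)  =
    mk⇔ (λ a≡ → contradiction a≡ (proj₁ (new q∈))) (λ b≡ → contradiction b≡ (proj₂ (new q∈)))
  sameVertex extendPartialIso (there p∈)  (here refl) =
    mk⇔ (λ ≡a → contradiction (sym ≡a) (proj₁ (new p∈))) (λ ≡b → contradiction (sym ≡b) (proj₂ (new p∈)))
  sameVertex extendPartialIso (there p∈)  (there q∈)  = sameVertex iso p∈ q∈
  sameSimp extendPartialIso σ σ⊆ with newOrOld σ σ⊆
  ... | inj₂ σ⊆P  = sameSimp iso σ σ⊆P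
  ... | inj₁ ab∈σ = begin
    Simp K (map proj₁ σ)                     ≈⟨ simplex-⇔ isK (map-SameElements proj₁ same) ⟩
    Simp K (a ∷ map proj₁ (oldPairs σ σ⊆))   ≈⟨ cone (oldPairs σ σ⊆) (oldPairs⊆P σ σ⊆) ⟩
    Simp L (b ∷ map proj₂ (oldPairs σ σ⊆))   ≈⟨ simplex-⇔ isL (map-SameElements proj₂ same) ⟨
    Simp L (map proj₂ σ)                     ∎
    where
    open ⇔-Reasoning
    same : SameElements σ ((a , b) ∷ oldPairs σ σ⊆)
    same = oldPairs-same σ σ⊆ ab∈σ

ExtensionProperty : Complex → Set₁
ExtensionProperty L = ∀ {K} → IsComplex K → ∀ {P : Pairs K L} → PartialIso K L P →
                      ∀ a → ¬ (∃[ b ] (a , b) ∈ P) → ∃[ b ] PartialIso K L ((a , b) ∷ P)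

Stage : Complex → Complex → Set
Stage K L = Σ (Pairs K L) (PartialIso K L)

module Chain {K L} (stage : ℕ → Stage K L) (grows : ∀ k → proj₁ (stage k) ⊑ proj₁ (stage (suc k))) where

  pairsAt : ℕ → Pairs K L
  pairsAt k = proj₁ (stage k)

  chain-⊑ : ∀ {i j} → i ≤ j → pairsAt i ⊑ pairsAt j
  chain-⊑ i≤j = along (≤⇒≤′ i≤j)
    where
    along : ∀ {i j} → i ≤′ j → pairsAt i ⊑ pairsAt j
    along ≤′-refl        p∈ = p∈
    along (≤′-step i≤′j) p∈ = grows _ (along i≤′j p∈)

  chain-sameVertex : ∀ i j {p q} → p ∈ pairsAt i → q ∈ pairsAt j → (proj₁ p ≡ proj₁ q ⇔ proj₂ p ≡ proj₂ q)
  chain-sameVertex i j p∈ q∈ =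
    sameVertex (proj₂ (stage (i ⊔ j))) (chain-⊑ (m≤m⊔n i j) p∈) (chain-⊑ (m≤n⊔m i j) q∈)

  module _ (ψ : Vert K → Vert L) (idx : Vert K → ℕ) (graph∈ : ∀ w → (w , ψ w) ∈ pairsAt (idx w)) where

    graphAt : ∀ σ → ∃[ N ] All (_∈ pairsAt N) (map (λ w → w , ψ w) σ)
    graphAt []      = 0 , []
    graphAt (w ∷ σ) with graphAt σ
    ... | N , graph⊆ = idx w ⊔ N , chain-⊑ (m≤m⊔n (idx w) N) (graph∈ w) ∷ All.map (chain-⊑ (m≤n⊔m (idx w) N)) graph⊆

    chain-simp : ∀ σ → Simp K σ ⇔ Simp L (map ψ σ)
    chain-simp σ = subst₂ _⇔_ (cong (Simp K) (trans (sym (map-∘ σ)) (map-id σ))) (cong (Simp L) (sym (map-∘ σ)))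
                     (sameSimp (proj₂ (stage (proj₁ (graphAt σ)))) (map (λ w → w , ψ w) σ) (proj₂ (graphAt σ)))

subset-element-≡ : {A : Set} {U : A → Bool} {x y : Σ A (λ v → T (U v))} → proj₁ x ≡ proj₁ y → x ≡ y
subset-element-≡ {x = v , u} {.v , u'} refl = cong (v ,_) (T-irrelevant u u')

elementsIn : {A : Set} (U : A → Bool) → List A → List (Σ A (λ v → T (U v)))
elementsIn U []       = []
elementsIn U (x ∷ xs) with T? (U x)
... | yes x∈U = (x , x∈U) ∷ elementsIn U xs
... | no  _   = elementsIn U xs

elementsIn-∈ : {A : Set} {U : A → Bool} {xs : List A} {v : A} (v∈U : T (U v)) → v ∈ xs → (v , v∈U) ∈ elementsIn U xs
elementsIn-∈ {U = U} {x ∷ xs} v∈U v∈ with T? (U x) | v∈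
... | yes _   | here refl = here (subset-element-≡ refl)
... | yes _   | there v∈' = there (elementsIn-∈ v∈U v∈')
... | no  x∉U | here refl = contradiction v∈U x∉U
... | no  _   | there v∈' = elementsIn-∈ v∈U v∈'

module _ {Y : Complex} {U U' : Subset Y} (φ : Iso (Induced Y U) (Induced Y U')) where

  graphOver : List (Vert Y) → Pairs Y Y
  graphOver xs = map (λ s → proj₁ s , proj₁ (isoMap φ s)) (elementsIn U xs)

  graphOver-∈ : ∀ {xs v} {v∈U : T (U v)} → v ∈ xs → (v , proj₁ (isoMap φ (v , v∈U))) ∈ graphOver xs
  graphOver-∈ v∈ = ∈-map⁺ _ (elementsIn-∈ _ v∈)

  graphOver-partialIso : ∀ xs → PartialIso Y Y (graphOver xs)
  sameVertex (graphOver-partialIso xs) p∈ q∈ with ∈-map⁻ _ p∈ | ∈-map⁻ _ q∈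
  ... | s , _ , refl | s' , _ , refl =
    mk⇔ (λ e → cong (λ t → proj₁ (isoMap φ t)) (subset-element-≡ e))
        (λ e → cong proj₁ (Injection.injective (↔⇒↣ (bij φ)) (subset-element-≡ e)))
  sameSimp (graphOver-partialIso xs) σ σ⊆ with lift-map _ σ σ⊆
  ... | τ , _ , refl = subst₂ _⇔_ (cong (Simp Y) (map-∘ τ)) (cong (Simp Y) (trans (sym (map-∘ τ)) (map-∘ τ)))
                                  (preserve φ τ)

ImageAndPreimage : {Y : Complex} → Pairs Y Y → Vert Y → Set
ImageAndPreimage P w = (∃[ v ] (w , v) ∈ P) × (∃[ u ] (u , w) ∈ P)

-- Excluded middle decides whether a vertex already has an image, which vertex has a given code, and
-- which vertices lie in the range of an embedding.
module BackAndForth (em : ExcludedMiddle 0ℓ) where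

  forth : ∀ {K L} → IsComplex K → ExtensionProperty L → (s : Stage K L) (a : Vert K) →
          Σ[ s' ∈ Stage K L ] proj₁ s ⊑ proj₁ s' × ∃[ b ] (a , b) ∈ proj₁ s'
  forth isK extL (P , iso) a with em {∃[ b ] (a , b) ∈ P}
  ... | yes (b , ab∈) = (P , iso) , (λ p∈ → p∈) , b , ab∈
  ... | no  fresh     with extL isK iso a fresh
  ...   | b , iso'    = ((a , b) ∷ P , iso') , there , b , here refl

  -- Enlarge a stage so that the vertex b of L gets a preimage: go forth on the reversed stage.
  back : ∀ {K L} → IsComplex L → ExtensionProperty K → (s : Stage K L) (b : Vert L) →
         Σ[ s' ∈ Stage K L ] proj₁ s ⊑ proj₁ s' × ∃[ a ] (a , b) ∈ proj₁ s'
  back isL extK (P , iso) b with forth isL extK (map swap P , swapPartialIso iso) b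
  ... | (P' , iso') , P⊑P' , a , ba∈ =
    (map swap P' , swapPartialIso iso') , (λ p∈ → ∈-map⁺ swap (P⊑P' (∈-map⁺ swap p∈))) , a , ∈-map⁺ swap ba∈

  module Sweep {K L} (cK : Countable K) (Handled : Pairs K L → Vert K → Set)
               (treat : Stage K L → Vert K → Stage K L)
               (treat-⊒ : ∀ s w → proj₁ s ⊑ proj₁ (treat s w))
               (treat-handles : ∀ s w → Handled (proj₁ (treat s w)) w)
               (start : Stage K L) where

    code : Vert K → ℕ
    code = proj₁ cK

    step : ∀ k → Dec (∃[ w ] code w ≡ k) → Stage K L → Stage K L
    step k (yes (w , _)) s = treat s w
    step k (no  _)       s = s

    stage : ℕ → Stage K L
    stage zero    = start
    stage (suc k) = step k em (stage k)

    grows : ∀ k → proj₁ (stage k) ⊑ proj₁ (stage (suc k))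
    grows k = step-⊒ em (stage k)
      where
      step-⊒ : ∀ d s → proj₁ s ⊑ proj₁ (step k d s)
      step-⊒ (yes (w , _)) s = treat-⊒ s w
      step-⊒ (no  _)       s = λ p∈ → p∈

    open Chain stage grows public

    handled : ∀ w → Handled (pairsAt (suc (code w))) w
    handled w = step-handles em (stage (code w))
      where
      step-handles : ∀ d s → Handled (proj₁ (step (code w) d s)) w
      step-handles (yes (w' , code≡)) s with proj₂ cK code≡
      ... | refl = treat-handles s w
      step-handles (no ∄) s = contradiction (w , refl) ∄

  universal : ∀ {L} → IsComplex L → ExtensionProperty L → Universal L
  universal {L} isL extL K isK cK = U , record { bij = mk↔ₛ′ to from to∘from from∘to ; preserve = embed-simp }
    where
    open Sweep cK (λ P w → ∃[ b ] (w , b) ∈ P) (λ s w → proj₁ (forth isK extL s w))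
               (λ s w → proj₁ (proj₂ (forth isK extL s w))) (λ s w → proj₂ (proj₂ (forth isK extL s w)))
               ([] , emptyPartialIso isK isL)
    embed : Vert K → Vert L
    embed w = proj₁ (handled w)
    embed-injective : ∀ {w w'} → embed w ≡ embed w' → w ≡ w'
    embed-injective {w} {w'} =
      Equivalence.from (chain-sameVertex (suc (code w)) (suc (code w')) (proj₂ (handled w)) (proj₂ (handled w')))
    InRange : Vert L → Set
    InRange v = ∃[ w ] embed w ≡ v
    U : Subset L
    U v = isYes (em {InRange v})
    to : Vert K → Σ (Vert L) (λ v → T (U v))
    to w = embed w , fromWitness (w , refl)
    from : Σ (Vert L) (λ v → T (U v)) → Vert K
    from (v , v∈U) = proj₁ (toWitness {a? = em {InRange v}} v∈U)
    to∘from : ∀ y → to (from y) ≡ y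
    to∘from (v , v∈U) = subset-element-≡ (proj₂ (toWitness {a? = em {InRange v}} v∈U))
    from∘to : ∀ w → from (to w) ≡ w
    from∘to w = embed-injective (proj₂ (toWitness {a? = em {InRange (embed w)}} (proj₂ (to w))))
    embed-simp : ∀ σ → Simp K σ ⇔ Simp L (map proj₁ (map to σ))
    embed-simp σ = subst (λ τ → Simp K σ ⇔ Simp L τ) (map-∘ σ) (chain-simp embed (suc ∘ code) (λ w → proj₂ (handled w)) σ)

  forthAndBack : ∀ {Y} → IsComplex Y → ExtensionProperty Y → (s : Stage Y Y) (w : Vert Y) →
                 Σ[ s' ∈ Stage Y Y ] proj₁ s ⊑ proj₁ s' × ImageAndPreimage {Y} (proj₁ s') w
  forthAndBack isY extY s w with forth isY extY s w
  ... | s' , s⊑s' , v , wv∈ with back isY extY s' w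
  ...   | s'' , s'⊑s'' , u , uw∈ = s'' , (λ p∈ → s'⊑s'' (s⊑s' p∈)) , (v , s'⊑s'' wv∈) , (u , uw∈)

  -- A countable complex with the extension property is homogeneous: going back and forth from the
  -- graph of a finite isomorphism φ yields an automorphism extending it.
  homogeneous : ∀ {Y} → IsComplex Y → Countable Y → ExtensionProperty Y → Homogeneous Y
  homogeneous {Y} isY cY extY U U' (listU , listU-covers) _ φ = ψ , extends
    where
    open Sweep cY (ImageAndPreimage {Y}) (λ s w → proj₁ (forthAndBack isY extY s w))
               (λ s w → proj₁ (proj₂ (forthAndBack isY extY s w))) (λ s w → proj₂ (proj₂ (forthAndBack isY extY s w)))
               (graphOver {Y} φ listU , graphOver-partialIso {Y} φ listU)

    image preimage : Vert Y → Vert Y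
    image    w = proj₁ (proj₁ (handled w))
    preimage w = proj₁ (proj₂ (handled w))

    image∈ : ∀ w → (w , image w) ∈ pairsAt (suc (code w))
    image∈ w = proj₂ (proj₁ (handled w))

    preimage∈ : ∀ w → (preimage w , w) ∈ pairsAt (suc (code w))
    preimage∈ w = proj₂ (proj₂ (handled w))

    image∘preimage : ∀ w → image (preimage w) ≡ w
    image∘preimage w =
      Equivalence.to (chain-sameVertex (suc (code (preimage w))) (suc (code w)) (image∈ (preimage w)) (preimage∈ w)) refl

    preimage∘image : ∀ w → preimage (image w) ≡ w
    preimage∘image w =
      Equivalence.from (chain-sameVertex (suc (code (image w))) (suc (code w)) (preimage∈ (image w)) (image∈ w)) refl

    ψ : Iso Y Y
    ψ = record { bij = mk↔ₛ′ image preimage image∘preimage preimage∘image ; preserve = chain-simp image (suc ∘ code) image∈ }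

    extends : ∀ v (v∈U : T (U v)) → proj₁ (isoMap φ (v , v∈U)) ≡ isoMap ψ v
    extends v v∈U =
      Equivalence.to (chain-sameVertex 0 (suc (code v)) (graphOver-∈ {Y} φ (listU-covers v v∈U)) (image∈ v)) refl

module XExtension (em : ExcludedMiddle 0ℓ) {K} (isK : IsComplex K) {P : Pairs K X} (iso : PartialIso K X P)
                  (a : Vert K) (fresh : ¬ (∃[ b ] (a , b) ∈ P)) where

  images : List ℕ
  images = map proj₂ P

  -- Exceeds every vertex in the image of P and bounds the code of every face of the image.
  bound : ℕ
  bound = primeProduct (enumerate images)

  faceCode≤bound : ∀ {R} → Increasing R → All (_∈ images) R → primeProduct R ≤ bound
  faceCode≤bound R↑ R⊆ = primeProduct-⊆ (members⇒⊆ R↑ (enumerate-increasing images)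
                           (λ v∈ → Equivalence.from (enumerate-∈ images _) (All.lookup R⊆ v∈)))

  image<bound : ∀ {x} → x ∈ images → x < bound
  image<bound {x} x∈ = <-≤-trans (n<pr x) (subst (_≤ bound) (*-identityʳ (pr x))
                         (primeProduct-⊆ (from∈ (Equivalence.from (enumerate-∈ images x) x∈))))

  Wanted : ℕ → Set
  Wanted j = ∃[ τ ] All (_∈ P) τ × Increasing (map proj₂ τ) × primeProduct (map proj₂ τ) ≡ j
                    × Simp K (a ∷ map proj₁ τ)

  wanted? : ℕ → Bool
  wanted? j = does (em {Wanted j})

  -- The new vertex b: the binary digits of b + 1 below bound + 1 mark the wanted codes.
  b : ℕ
  b = pred (withDigits (suc bound) wanted?)

  suc-b : suc b ≡ withDigits (suc bound) wanted?
  suc-b = suc-pred _ {{>-nonZero (≤-<-trans z≤n (withDigits>n (suc bound) wanted?))}}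

  bound<b : bound < b
  bound<b = ≤-pred (subst (suc (suc bound) ≤_) (sym suc-b) (withDigits>n (suc bound) wanted?))

  image<b : ∀ {x} → x ∈ images → x < b
  image<b x∈ = <-trans (image<bound x∈) bound<b

  faceDigit-b : ∀ {R} → Increasing R → All (_∈ images) R → faceDigit b R ≡ 1 ⇔ Wanted (primeProduct R)
  faceDigit-b {R} R↑ R⊆ = subst (λ d → d ≡ 1 ⇔ Wanted (primeProduct R)) (sym digit≡) (digitValue-does em)
    where
    open ≡-Reasoning
    digit≡ : faceDigit b R ≡ digitValue (wanted? (primeProduct R))
    digit≡ = begin
      binDigit (suc b) (primeProduct R)                           ≡⟨ cong (λ w → binDigit w (primeProduct R)) suc-b ⟩
      binDigit (withDigits (suc bound) wanted?) (primeProduct R)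
        ≡⟨ withDigits-digit (suc bound) wanted? (s≤s (faceCode≤bound R↑ R⊆)) ⟩
      digitValue (wanted? (primeProduct R))                       ∎

  below-b : ∀ {m R B₀} → m ≤ b → All (_< m) R → All (_∈ b ∷ B₀) R → All (_∈ B₀) R
  below-b m≤b R<m R⊆ = All.zipWith (λ { (r<m , here refl) → contradiction (<-≤-trans r<m m≤b) (<-irrefl refl)
                                       ; (_ , there r∈) → r∈ }) (R<m , R⊆)

  module _ (σ₀ : Pairs K X) (σ₀⊆P : All (_∈ P) σ₀) where

    B₀⊆images : map proj₂ σ₀ ⊑ images
    B₀⊆images = ⊑-map⁺ proj₂ (All.lookup σ₀⊆P)

    -- If a spans a simplex with the preimage of B₀ = map proj₂ σ₀, then b ∷ B₀ satisfies the digit condition: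
    -- at b because every face of B₀ is wanted, below b because B₀ is a simplex of X.
    cone⇒ : Simp K (a ∷ map proj₁ σ₀) → XSimp (b ∷ map proj₂ σ₀)
    cone⇒ a-simp = digitCondition⇒XSimp (λ ()) digits
      where
      digits : DigitCondition (b ∷ map proj₂ σ₀)
      digits m R (here refl) _ R↑ R<b R⊆ with below-b ≤-refl R<b R⊆
      ... | R⊆B₀ with lift-map proj₂ R R⊆B₀
      ...   | τ , τ⊆σ₀ , refl = Equivalence.from (faceDigit-b R↑ (All.map B₀⊆images R⊆B₀))
                                  (τ , All.map (All.lookup σ₀⊆P) τ⊆σ₀ , R↑ , refl , face-simp)
        where
        face-simp : Simp K (a ∷ map proj₁ τ)
        face-simp = IsComplex.downClosed isK _ _ a-simp (λ ()) (λ v → ∷⁺ʳ a (⊑-map⁺ proj₁ (All.lookup τ⊆σ₀)))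
      digits m R (there m∈B₀) R≢[] R↑ R<m R⊆ =
        XSimp⇒digitCondition B₀-simp m R m∈B₀ R≢[] R↑ R<m (below-b (<⇒≤ (image<b (B₀⊆images m∈B₀))) R<m R⊆)
        where
        A₀≢[] : map proj₁ σ₀ ≢ []
        A₀≢[] with ∈-map⁻ proj₂ m∈B₀
        ... | p , p∈σ₀ , _ = ∈⇒≢[] (∈-map⁺ proj₁ p∈σ₀)
        B₀-simp : XSimp (map proj₂ σ₀)
        B₀-simp = Equivalence.to (sameSimp iso σ₀ σ₀⊆P)
                    (IsComplex.downClosed isK _ _ a-simp A₀≢[] (λ _ → there))

    -- Conversely, if b ∷ B₀ is a simplex of X, then the code of (the increasing enumeration of) B₀ is
    -- wanted; by unique factorisation the face witnessing this is B₀ itself.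
    cone⇐ : σ₀ ≢ [] → XSimp (b ∷ map proj₂ σ₀) → Simp K (a ∷ map proj₁ σ₀)
    cone⇐ σ₀≢[] b-simp = face⇒cone (Equivalence.to (faceDigit-b R↑ R⊆images) code-digit)
      where
      B₀ : List ℕ
      B₀ = map proj₂ σ₀
      R : List ℕ
      R = enumerate B₀
      R↑ : Increasing R
      R↑ = enumerate-increasing B₀
      R⊆B₀ : R ⊑ B₀
      R⊆B₀ {v} = Equivalence.to (enumerate-∈ B₀ v)
      R⊆images : All (_∈ images) R
      R⊆images = All.tabulate (λ v∈ → B₀⊆images (R⊆B₀ v∈))
      R≢[] : R ≢ []
      R≢[] = ∈⇒≢[] (Equivalence.from (enumerate-∈ B₀ _) (∈-map⁺ proj₂ (proj₂ (≢[]⇒∈ σ₀≢[]))))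
      code-digit : faceDigit b R ≡ 1
      code-digit = XSimp⇒digitCondition b-simp b R (here refl) R≢[] R↑
                     (All.tabulate (λ v∈ → image<b (All.lookup R⊆images v∈))) (All.tabulate (λ v∈ → there (R⊆B₀ v∈)))
      face⇒cone : Wanted (primeProduct R) → Simp K (a ∷ map proj₁ σ₀)
      face⇒cone (τ , τ⊆P , τ↑ , same-code , a-simp) =
        IsComplex.downClosed isK _ _ a-simp (λ ()) (λ v → ∷⁺ʳ a (sameDomain iso σ₀⊆P τ⊆P B₀⊆τ))
        where
        τ≡R : map proj₂ τ ≡ R
        τ≡R = primeProduct-injective τ↑ R↑ same-code
        B₀⊆τ : B₀ ⊑ map proj₂ τ
        B₀⊆τ y∈ = subst (_ ∈_) (sym τ≡R) (Equivalence.from (enumerate-∈ B₀ _) y∈)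

  cone : ∀ σ₀ → All (_∈ P) σ₀ → Simp K (a ∷ map proj₁ σ₀) ⇔ XSimp (b ∷ map proj₂ σ₀)
  cone []          σ₀⊆P = mk⇔ (cone⇒ [] σ₀⊆P) (λ _ → IsComplex.singleton isK a)
  cone σ₀@(_ ∷ _) σ₀⊆P = mk⇔ (cone⇒ σ₀ σ₀⊆P) (cone⇐ σ₀ σ₀⊆P (λ ()))

  new : ∀ {q} → q ∈ P → a ≢ proj₁ q × b ≢ proj₂ q
  new {q} q∈ = (λ a≡ → fresh (proj₂ q , subst (λ v → (v , proj₂ q) ∈ P) (sym a≡) q∈))
             , (λ b≡ → <⇒≢ (image<b (∈-map⁺ proj₂ q∈)) (sym b≡))

X-extensionProperty : ExcludedMiddle 0ℓ → ExtensionProperty X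
X-extensionProperty em isK iso a fresh = b , extendPartialIso isK X-isComplex iso new cone
  where open XExtension em isK iso a fresh

X-countable : Countable X
X-countable = (λ v → v) , (λ e → e)

mainTheorem5 : ExcludedMiddle 0ℓ → IsRado X
mainTheorem5 em = X-isComplex , X-countable , universal X-isComplex extX , homogeneous X-isComplex X-countable extX
  where
  open BackAndForth em
  extX : ExtensionProperty X
  extX = X-extensionProperty em
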